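{- Let $d\in\mathbb{N}$. If $t(d,n)$ is unbounded as a function of $n$, then in every digraph with minimum out-degree at least $d+1$, each pair of distinct vertices is separable by a friendly partition.
   Context: Digraphs are finite, without loops and without parallel arcs in the same direction. A friendly partition of a digraph $G=(V,E)$ is an unordered partition $\{V_1,V_2\}$ of $V$ into two nonempty sets such that every vertex has at least one out-neighbor in its own part; it separates vertices $u,v$ if they lie in different parts. $t(d,n)$ denotes the minimum, over all digraphs with $n$ vertices and minimum out-degree (at least) $d$, of the number of friendly partitions of the digraph. -}

module Defs where

open import Data.Nat using (ℕ; zero; suc; _≤_; _<_; _/_)
open import Data.Bool using (Bool; true; false; if_then_else_)
import Data.Bool.Properties as BoolP
open import Data.Fin using (Fin)
import Data.Fin.Properties as FinP
open import Data.List using (List; []; _∷_; [_]; length; filter; concatMap; map; allFin)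
open import Data.Nat.ListAction using (sum)
open import Data.Vec.Functional using (Vector) renaming (_∷_ to _∷ᶠ_)
open import Data.Product using (Σ; ∃; ∃-syntax; _×_; _,_)
open import Relation.Binary.PropositionalEquality using (_≡_; _≢_)
open import Relation.Nullary using (Dec; ¬_)
open import Relation.Nullary.Decidable using (_×-dec_)

record Digraph (n : ℕ) : Set where
  field
    arc      : Fin n → Fin n → Bool
    loopless : ∀ i → arc i i ≡ false
open Digraph public

outdeg : ∀ {n} → Digraph n → Fin n → ℕ
outdeg {n} G i = sum (map (λ j → if arc G i j then 1 else 0) (allFin n))

MinOutDeg≥ : ∀ {n} → ℕ → Digraph n → Set
MinOutDeg≥ d G = ∀ i → d ≤ outdeg G i

-- A 2-partition {V₁,V₂} is encoded by a colouring c : Fin n → Bool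
-- (V₁ = c⁻¹(true), V₂ = c⁻¹(false)); c and (not ∘ c) encode the same
-- unordered partition.
Colouring : ℕ → Set
Colouring n = Fin n → Bool

Friendly : ∀ {n} → Digraph n → Colouring n → Set
Friendly G c =
  (∃[ i ] c i ≡ true) × (∃[ j ] c j ≡ false) ×
  (∀ i → ∃[ j ] (arc G i j ≡ true × c j ≡ c i))

friendly? : ∀ {n} (G : Digraph n) (c : Colouring n) → Dec (Friendly G c)
friendly? G c =
  FinP.any? (λ i → c i BoolP.≟ true) ×-dec
  (FinP.any? (λ j → c j BoolP.≟ false) ×-dec
   FinP.all? (λ i → FinP.any? (λ j → (arc G i j BoolP.≟ true) ×-dec (c j BoolP.≟ c i))))

allColourings : (n : ℕ) → List (Colouring n)
allColourings zero = [ (λ ()) ]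
allColourings (suc n) = concatMap (λ c → (false ∷ᶠ c) ∷ (true ∷ᶠ c) ∷ []) (allColourings n)

-- number of friendly (unordered) partitions: each unordered partition
-- into two nonempty parts corresponds to exactly two colourings.
numFriendly : ∀ {n} → Digraph n → ℕ
numFriendly {n} G = length (filter (friendly? G) (allColourings n)) / 2

-- "t(d,n) > B": t(d,n) is a genuine minimum (some digraph on n vertices with
-- minimum out-degree ≥ d exists) and every such digraph has more than B
-- friendly partitions.
t>_at_ : ℕ → ℕ → ℕ → Set
(t> B at d) n =
  (Σ (Digraph n) (MinOutDeg≥ d)) ×
  (∀ (G : Digraph n) → MinOutDeg≥ d G → B < numFriendly G)

TUnbounded : ℕ → Set
TUnbounded d = ∀ B → ∃[ n ] (t> B at d) n

Separable : ∀ {n} → Digraph n → Fin n → Fin n → Set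
Separable G u v = ∃[ c ] (Friendly G c × c u ≢ c v)

-- Suppose u ≠ v are not separated by any friendly partition of G, where every
-- out-degree is at least d + 1. Delete all arcs into v and add N clones of v
-- (copies of its out-neighbourhood, with no arcs into them). Out-degrees drop
-- by at most one, so the new digraph has minimum out-degree at least d. In any
-- friendly colouring of it every out-neighbour w of v gets the colour of u:
-- otherwise recolouring v like w yields a friendly partition of G separating
-- u and v. Hence every clone, which has a same-coloured out-neighbour among
-- those w, is coloured like u, so a friendly colouring is determined by the
-- original n vertices. The digraphs obtained for all N thus have at most 2ⁿ
-- friendly partitions, contradicting the unboundedness of t(d, ·).
module Submission where

open import Defs
open import Data.Nat using (ℕ; suc; zero; _+_; _*_; _^_; _∸_; _≤_; _<_; z≤n; s≤s)
import Data.Nat.Properties as ℕ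
open import Data.Nat.DivMod using (m/n≤m)
open import Data.Nat.ListAction using (sum)
open import Data.Bool using (Bool; true; false; _∧_; not; if_then_else_)
import Data.Bool.Properties as Bool
open import Data.Fin using (Fin; zero; suc; _↑ˡ_; _↑ʳ_; splitAt)
import Data.Fin.Properties as Fin
open import Data.Fin.Subset.Properties using (anySubset?)
open import Data.List using (List; []; _∷_; length; filter; concatMap; map; allFin)
import Data.List.Properties as List
open import Data.Vec using (lookup; tabulate)
open import Data.Vec.Properties using (lookup∘tabulate)
open import Data.Vec.Functional using (updateAt) renaming (_∷_ to _∷ᶠ_)
open import Data.Vec.Functional.Properties using (updateAt-updates; updateAt-minimal)
open import Data.Product using (Σ; ∃-syntax; _×_; _,_; proj₁; proj₂)
open import Data.Sum using (_⊎_; inj₁; inj₂)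
open import Function using (_∘_; id; const)
open import Relation.Binary.PropositionalEquality
  using (_≡_; _≢_; _≗_; refl; sym; trans; cong; subst; module ≡-Reasoning)
open import Relation.Nullary using (Dec; yes; no; ¬_; does; contradiction)
open import Relation.Nullary.Decidable
  using (_×-dec_; _⊎-dec_; ¬?; map′; dec-false; decidable-stable)
open import Relation.Unary using (Decidable)

private
  variable
    m n : ℕ

count : (Fin m → Bool) → ℕ
count {m} a = sum (map (λ j → if a j then 1 else 0) (allFin m))

count-suc : (a : Fin (suc m) → Bool) →
  count a ≡ (if a zero then 1 else 0) + count (a ∘ suc)
count-suc {m} a = cong (λ l → (if a zero then 1 else 0) + sum l)
  (trans (List.map-tabulate suc (λ j → if a j then 1 else 0))
         (sym (List.map-tabulate id (λ j → if a (suc j) then 1 else 0))))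

count-cong : {a b : Fin m → Bool} → a ≗ b → count a ≡ count b
count-cong {m} a≗b = cong sum (List.map-cong (cong (λ b → if b then 1 else 0) ∘ a≗b) (allFin m))

count-≤-suc : {a b : Fin m → Bool} (v : Fin m) →
  (∀ j → j ≢ v → a j ≡ b j) → count a ≤ suc (count b)
count-≤-suc {suc m} {a} {b} zero agree
  rewrite count-suc a | count-suc b | count-cong {a = a ∘ suc} (λ j → agree (suc j) λ ())
  with a zero
... | true  = s≤s (ℕ.m≤n+m _ _)
... | false = ℕ.m≤n⇒m≤1+n (ℕ.m≤n+m _ _)
count-≤-suc {suc m} {a} {b} (suc v) agree
  rewrite count-suc a | count-suc b | agree zero (λ ()) =
  ℕ.≤-trans (ℕ.+-monoʳ-≤ _ (count-≤-suc v (λ j j≢v → agree (suc j) (j≢v ∘ Fin.suc-injective))))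
            (ℕ.≤-reflexive (ℕ.+-suc _ _))

count-↑ʳ : ∀ N (a : Fin (N + n) → Bool) →
  (∀ i → a (i ↑ˡ n) ≡ false) → count a ≡ count (a ∘ (N ↑ʳ_))
count-↑ʳ zero    a _ = refl
count-↑ʳ (suc N) a prefixFalse
  rewrite count-suc a | prefixFalse zero = count-↑ʳ N (a ∘ suc) (prefixFalse ∘ suc)

Satisfied : Digraph n → Colouring n → Set
Satisfied G c = ∀ i → ∃[ j ] (arc G i j ≡ true × c j ≡ c i)

SatisfiedAwayFrom : Digraph n → Fin n → Colouring n → Set
SatisfiedAwayFrom G v c = ∀ k → k ≢ v → ∃[ l ] (arc G k l ≡ true × l ≢ v × c l ≡ c k)

Separates : Digraph n → Fin n → Fin n → Colouring n → Set
Separates G u v c = Friendly G c × c u ≢ c v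

separates? : (G : Digraph n) (u v : Fin n) → Decidable (Separates G u v)
separates? G u v c = friendly? G c ×-dec ¬? (c u Bool.≟ c v)

Separates-resp-≗ : {G : Digraph n} {u v : Fin n} {c c′ : Colouring n} →
  c ≗ c′ → Separates G u v c → Separates G u v c′
Separates-resp-≗ {u = u} {v} c≗c′ (((i , ci) , (j , cj) , sat) , cu≢cv) =
  ((i , trans (sym (c≗c′ i)) ci) , (j , trans (sym (c≗c′ j)) cj) ,
   λ k → let (l , k→l , cl) = sat k in l , k→l , trans (sym (c≗c′ l)) (trans cl (c≗c′ k))) ,
  λ c′u≡c′v → cu≢cv (trans (c≗c′ u) (trans c′u≡c′v (sym (c≗c′ v))))

separable? : (G : Digraph n) (u v : Fin n) → Dec (Separable G u v)
separable? G u v = map′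
  (λ (s , sep) → lookup s , sep)
  (λ (c , sep) → tabulate c , Separates-resp-≗ {G = G} {u} {v} (sym ∘ lookup∘tabulate c) sep)
  (anySubset? (separates? G u v ∘ lookup))

satisfied-separating⇒separable : {G : Digraph n} {u v : Fin n} {c : Colouring n} →
  Satisfied G c → c u ≢ c v → Separable G u v
satisfied-separating⇒separable {u = u} {v} {c} sat cu≢cv = c , (proj₁ bothParts , proj₂ bothParts , sat) , cu≢cv
  where
  bothParts : (∃[ i ] c i ≡ true) × (∃[ j ] c j ≡ false)
  bothParts with c u in cu | c v in cv
  ... | true  | true  = contradiction refl cu≢cv
  ... | true  | false = (u , cu) , (v , cv)
  ... | false | true  = (v , cv) , (u , cu)
  ... | false | false = contradiction refl cu≢cv

outNeighbour≢ : (G : Digraph n) {v w : Fin n} → arc G v w ≡ true → w ≢ v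
outNeighbour≢ G {v} v→w refl with () ← trans (sym v→w) (loopless G v)

-- No vertex other than v needs v as its same-coloured out-neighbour, so v may
-- take the colour of any of its own out-neighbours.
recolour-satisfied : {G : Digraph n} {v w : Fin n} {c : Colouring n} →
  arc G v w ≡ true → SatisfiedAwayFrom G v c →
  Satisfied G (updateAt c v (const (c w)))
recolour-satisfied {G = G} {v} {w} {c} v→w away k with k Fin.≟ v
... | yes refl = w , v→w ,
  trans (updateAt-minimal w v c (outNeighbour≢ G v→w)) (sym (updateAt-updates v c))
... | no k≢v =
  let (l , k→l , l≢v , cl) = away k k≢v
  in l , k→l , trans (updateAt-minimal l v c l≢v) (trans cl (sym (updateAt-minimal k v c k≢v)))

inseparable⇒outNeighbour-coloured-like : {G : Digraph n} {u v w : Fin n} {c : Colouring n} →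
  ¬ Separable G u v → u ≢ v → arc G v w ≡ true → SatisfiedAwayFrom G v c → c w ≡ c u
inseparable⇒outNeighbour-coloured-like {G = G} {u} {v} {w} {c} ¬sep u≢v v→w away =
  decidable-stable (c w Bool.≟ c u) λ cw≢cu →
    ¬sep (satisfied-separating⇒separable {G = G} (recolour-satisfied {G = G} v→w away)
      λ c′u≡c′v → cw≢cu (sym (trans (sym (updateAt-minimal u v c u≢v))
                                    (trans c′u≡c′v (updateAt-updates v c)))))

PrefixColouredLike : ∀ N {n} → Fin n → Colouring (N + n) → Set
PrefixColouredLike N {n} u c = ∀ i → c (i ↑ˡ n) ≡ c (N ↑ʳ u)

module Cloning {n : ℕ} (G : Digraph n) (v : Fin n) (N : ℕ) where

  origin : Fin N ⊎ Fin n → Fin n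
  origin (inj₁ _) = v
  origin (inj₂ k) = k

  arc⊎ : Fin N ⊎ Fin n → Fin N ⊎ Fin n → Bool
  arc⊎ x (inj₁ _) = false
  arc⊎ x (inj₂ j) = arc G (origin x) j ∧ not (does (j Fin.≟ v))

  arc⊎-loopless : ∀ x → arc⊎ x x ≡ false
  arc⊎-loopless (inj₁ _) = refl
  arc⊎-loopless (inj₂ j) rewrite loopless G j = refl

  withClones : Digraph (N + n)
  withClones = record
    { arc      = λ x y → arc⊎ (splitAt N x) (splitAt N y)
    ; loopless = arc⊎-loopless ∘ splitAt N
    }

  outdeg-withClones : ∀ x → outdeg withClones x ≡ count (arc⊎ (splitAt N x) ∘ inj₂)
  outdeg-withClones x = trans
    (count-↑ʳ N _ (λ i → cong (arc⊎ (splitAt N x)) (Fin.splitAt-↑ˡ N i n)))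
    (count-cong (λ j → cong (arc⊎ (splitAt N x)) (Fin.splitAt-↑ʳ N n j)))

  withClones-minOutDeg : ∀ {d} → MinOutDeg≥ (suc d) G → MinOutDeg≥ d withClones
  withClones-minOutDeg {d} deg x = ℕ.≤-pred (begin
    suc d                               ≤⟨ deg (origin s) ⟩
    count (arc G (origin s))            ≤⟨ count-≤-suc v agree ⟩
    suc (count (arc⊎ s ∘ inj₂))         ≡⟨ cong suc (outdeg-withClones x) ⟨
    suc (outdeg withClones x)           ∎)
    where
    open ℕ.≤-Reasoning
    s : Fin N ⊎ Fin n
    s = splitAt N x
    agree : ∀ j → j ≢ v → arc G (origin s) j ≡ arc⊎ s (inj₂ j)
    agree j j≢v rewrite dec-false (j Fin.≟ v) j≢v = sym (Bool.∧-identityʳ _)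

  arc⊎⁻¹ : ∀ x j → arc⊎ x (inj₂ j) ≡ true → arc G (origin x) j ≡ true × j ≢ v
  arc⊎⁻¹ x j x→j with j Fin.≟ v
  ... | yes refl with () ← trans (sym (Bool.∧-zeroʳ _)) x→j
  ... | no j≢v = trans (sym (Bool.∧-identityʳ _)) x→j , j≢v

  withClones-arc⁻¹ : ∀ x y → arc withClones x y ≡ true →
    ∃[ l ] (y ≡ N ↑ʳ l × arc G (origin (splitAt N x)) l ≡ true × l ≢ v)
  withClones-arc⁻¹ x y x→y with splitAt N y in eq
  ... | inj₂ l = l , sym (Fin.splitAt⁻¹-↑ʳ eq) , arc⊎⁻¹ (splitAt N x) l x→y

  restriction-satisfiedAwayFrom : ∀ {c} → Satisfied withClones c →
    SatisfiedAwayFrom G v (c ∘ (N ↑ʳ_))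
  restriction-satisfiedAwayFrom sat k _ with sat (N ↑ʳ k)
  ... | y , k→y , cy with withClones-arc⁻¹ (N ↑ʳ k) y k→y
  ... | l , refl , k→l , l≢v rewrite Fin.splitAt-↑ʳ N n k = l , k→l , l≢v , cy

  clones-coloured-like : ∀ {u c} → ¬ Separable G u v → u ≢ v → Satisfied withClones c →
    PrefixColouredLike N u c
  clones-coloured-like ¬sep u≢v sat i with sat (i ↑ˡ n)
  ... | y , i→y , cy with withClones-arc⁻¹ (i ↑ˡ n) y i→y
  ... | l , refl , v→l , _ rewrite Fin.splitAt-↑ˡ N i n =
    trans (sym cy) (inseparable⇒outNeighbour-coloured-like {G = G} ¬sep u≢v v→l
                      (restriction-satisfiedAwayFrom sat))

open Cloning using (withClones; withClones-minOutDeg; clones-coloured-like)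

extensions : Colouring m → List (Colouring (suc m))
extensions c = (false ∷ᶠ c) ∷ (true ∷ᶠ c) ∷ []

length-allColourings : ∀ m → length (allColourings m) ≡ 2 ^ m
length-allColourings zero    = refl
length-allColourings (suc m) = trans (length-extensions (allColourings m))
                                     (cong (2 *_) (length-allColourings m))
  where
  length-extensions : (L : List (Colouring m)) → length (concatMap extensions L) ≡ 2 * length L
  length-extensions []      = refl
  length-extensions (c ∷ L) rewrite length-extensions L =
    cong suc (sym (ℕ.+-suc (length L) (length L + 0)))

length-filter-allColourings : {P : Colouring m → Set} (P? : Decidable P) →
  length (filter P? (allColourings m)) ≤ 2 ^ m
length-filter-allColourings {m} P? =
  ℕ.≤-trans (List.length-filter P? (allColourings m)) (ℕ.≤-reflexive (length-allColourings m))

numFriendly≤2^ : (H : Digraph m) → numFriendly H ≤ 2 ^ m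
numFriendly≤2^ H = ℕ.≤-trans (m/n≤m _ 2) (length-filter-allColourings (friendly? H))

module _ {P : Colouring (suc m) → Set} (P? : Decidable P) where

  extendable? : Decidable (λ c → P (false ∷ᶠ c) ⊎ P (true ∷ᶠ c))
  extendable? c = P? (false ∷ᶠ c) ⊎-dec P? (true ∷ᶠ c)

  length-filter-extensions : (∀ c → P (false ∷ᶠ c) → ¬ P (true ∷ᶠ c)) →
    ∀ L → length (filter P? (concatMap extensions L)) ≤ length (filter extendable? L)
  length-filter-extensions unique []      = z≤n
  length-filter-extensions unique (c ∷ L) with P? (false ∷ᶠ c)
  ... | yes p rewrite List.filter-reject P? {xs = concatMap extensions L} (unique c p)
    = s≤s (length-filter-extensions unique L)
  ... | no _ with P? (true ∷ᶠ c)
  ...   | yes _ = s≤s (length-filter-extensions unique L)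
  ...   | no _  = length-filter-extensions unique L

-- Such a colouring is determined by its last n entries.
length-filter-prefixColouredLike : ∀ N {n} (u : Fin n) {P : Colouring (N + n) → Set}
  (P? : Decidable P) → (∀ c → P c → PrefixColouredLike N u c) →
  length (filter P? (allColourings (N + n))) ≤ 2 ^ n
length-filter-prefixColouredLike zero    u P? _    = length-filter-allColourings P?
length-filter-prefixColouredLike (suc N) {n} u {P} P? like = ℕ.≤-trans
  (length-filter-extensions P? unique (allColourings (N + n)))
  (length-filter-prefixColouredLike N u (extendable? P?) like′)
  where
  unique : ∀ c → P (false ∷ᶠ c) → ¬ P (true ∷ᶠ c)
  unique c p q with () ← trans (like _ p zero) (sym (like _ q zero))
  like′ : ∀ c → P (false ∷ᶠ c) ⊎ P (true ∷ᶠ c) → PrefixColouredLike N u c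
  like′ c (inj₁ p) i = like _ p (suc i)
  like′ c (inj₂ q) i = like _ q (suc i)

numFriendly-withClones : ∀ {G : Digraph n} {u v : Fin n} → ¬ Separable G u v → u ≢ v →
  ∀ N → numFriendly (withClones G v N) ≤ 2 ^ n
numFriendly-withClones {G = G} {u} {v} ¬sep u≢v N = ℕ.≤-trans (m/n≤m _ 2)
  (length-filter-prefixColouredLike N u (friendly? (withClones G v N))
    (λ c friendly → clones-coloured-like G v N ¬sep u≢v (proj₂ (proj₂ friendly))))

t>⇒<2^ : ∀ {B d} → (t> B at d) m → B < 2 ^ m
t>⇒<2^ ((H , Hdeg) , bound) = ℕ.<-≤-trans (bound H Hdeg) (numFriendly≤2^ H)

t>2^⇒≤ : ∀ {d} → (t> 2 ^ n at d) m → n ≤ m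
t>2^⇒≤ t>at[m] = ℕ.≮⇒≥ λ m<n → ℕ.<-asym (t>⇒<2^ t>at[m]) (ℕ.^-monoʳ-< 2 (s≤s (s≤s z≤n)) m<n)

boundedFamily⇒¬TUnbounded : ∀ {d} →
  (∀ N → Σ (Digraph (N + n)) λ D → MinOutDeg≥ d D × numFriendly D ≤ 2 ^ n) →
  ¬ TUnbounded d
boundedFamily⇒¬TUnbounded {n} {d} family unbounded with unbounded (2 ^ n)
... | m , t>at[m]
  with family (m ∸ n) | subst (t> 2 ^ n at d) (sym (ℕ.m∸n+n≡m (t>2^⇒≤ {n = n} t>at[m]))) t>at[m]
... | D , Ddeg , D≤ | _ , bound = ℕ.<⇒≱ (bound D Ddeg) D≤

theorem1p9 : (d : ℕ) → TUnbounded d →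
    ∀ {n} (G : Digraph n) → MinOutDeg≥ (suc d) G →
    (u v : Fin n) → u ≢ v → Separable G u v
theorem1p9 d unbounded G deg u v u≢v =
  decidable-stable (separable? G u v) λ ¬sep →
    boundedFamily⇒¬TUnbounded
      (λ N → withClones G v N , withClones-minOutDeg G v N deg ,
             numFriendly-withClones ¬sep u≢v N)
      unbounded
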